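{- Let $k\ge1$, let $\mathcal H$ be a coideal of $\mathrm{FIN}_k^\infty$ and $A\in\mathcal H$. For every family $(\mathcal D_a)_{a\in\mathrm{FIN}_k^{<\infty}\upharpoonright A}$ such that each $\mathcal D_a$ is dense open in $\mathcal H\cap[\mathrm{depth}_A(a),A]$, there exists a sequence $(A_n)_{n\in\mathbb N}\subseteq\mathcal H\upharpoonright A$ such that $A_n\in\mathcal D_a$ for all $a\in\mathrm{FIN}_k^{<\infty}\upharpoonright A$ with $\mathrm{depth}_A(a)=n$.
   Context: $\mathrm{FIN}_k$ is the set of $p:\mathbb N\to\{0,\dots,k\}$ with finite support $\mathrm{supp}(p)=\{n:p(n)\ne0\}$ and $k$ in the range; $p<q$ means $\max\mathrm{supp}(p)<\min\mathrm{supp}(q)$. $\mathrm{FIN}_k^\infty$ / $\mathrm{FIN}_k^{<\infty}$: infinite / finite block sequences $(p_n)$ with $p_n<p_{n+1}$; $\mathrm{FIN}_k^{[d]}$: those of length $d$. $T(p)(n)=\max\{p(n)-1,0\}$. For a block sequence $A=(p_n)$, $[A]$ is the set of $T^{(i_0)}(p_{n_0})+\dots+T^{(i_l)}(p_{n_l})$ with $n_0<\dots<n_l$, $i_j\in\{0,\dots,k\}$, some $i_j=0$. $X\le Y$: every element of $X$ in $[Y]$. $r_n(A)$: first $n$ elements; $[a,A]=\{B:\exists n\ r_n(B)=a,\ B\le A\}$; $[n,A]=[r_n(A),A]$; $r_n[a,A]=\{r_n(B):B\in[a,A]\}$; $\mathrm{FIN}_k^{<\infty}\upharpoonright A=\{a:[a,A]\ne\emptyset\}$;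 $\mathrm{depth}_A(a)=\min\{n:a\le r_n(A)\}$; $\mathcal H\upharpoonright A=\{B\in\mathcal H:B\le A\}$. A coideal is $\mathcal H\subseteq\mathrm{FIN}_k^\infty$ such that: (a) $A\in\mathcal H$ and $A\triangle B$ finite imply $B\in\mathcal H$; (b) $A\in\mathcal H$, $A\le B$ imply $B\in\mathcal H$; (c) for $A\in\mathcal H$, $a\in\mathrm{FIN}_k^{<\infty}\upharpoonright A$: $[a,B]\ne\emptyset$ for all $B\in[\mathrm{depth}_A(a),A]\cap\mathcal H$, and if $B\in\mathcal H\upharpoonright A$, $[a,B]\ne\emptyset$, then some $A'\in[\mathrm{depth}_A(a),A]\cap\mathcal H$ has $\emptyset\ne[a,A']\subseteq[a,B]$; (d) for $A\in\mathcal H$, $a\in\mathrm{FIN}_k^{<\infty}\upharpoonright A$, $\mathcal O\subseteq\mathrm{FIN}_k^{[|a|+1]}$, some $B\in[\mathrm{depth}_A(a),A]\cap\mathcal H$ has $r_{|a|+1}[a,B]\subseteq\mathcal O$ or disjoint from $\mathcal O$. For $\mathcal D,\mathcal S\subseteq\mathcal H$, $\mathcal D$ is dense open in $\mathcal S$ if every $A\in\mathcal S$ has $B\in\mathcal D$ with $B\le A$, and $A\in\mathcal S$, $B\in\mathcal D$, $A\le B$ imply $A\in\mathcal D$. -}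

module Defs where

open import Data.Nat using (ℕ; zero; suc; _+_; _∸_; _≤_; _<_)
open import Data.Product using (Σ; ∃; _×_; _,_; proj₁; proj₂)
open import Data.Sum using (_⊎_)
open import Data.Unit using (⊤)
open import Data.List using (List; []; _∷_; length; applyUpTo)
open import Data.List.Relation.Unary.All using (All)
open import Data.List.Relation.Unary.Any using (Any)
open import Data.List.Relation.Unary.Linked using (Linked)
open import Data.List.Relation.Binary.Pointwise using (Pointwise)
open import Relation.Binary.PropositionalEquality using (_≡_; _≢_)
open import Relation.Nullary using (¬_)

-- Elements of FIN_k: functions p : ℕ → ℕ (values in {0..k}),
-- finite support, k attained.  Equality of elements is extensional.

Blk : Set
Blk = ℕ → ℕ

_≈_ : Blk → Blk → Set
p ≈ q = ∀ n → p n ≡ q n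

IsFIN : ℕ → Blk → Set
IsFIN k p = (∀ n → p n ≤ k)
          × (Σ ℕ λ N → ∀ n → N ≤ n → p n ≡ 0)
          × (Σ ℕ λ n → p n ≡ k)

-- p < q : max supp(p) < min supp(q)  (every support point of p is
-- below every support point of q; supports are nonempty for k ≥ 1)
_<ᵇ_ : Blk → Blk → Set
p <ᵇ q = ∀ m n → p m ≢ 0 → q n ≢ 0 → m < n

T : Blk → Blk
T p n = p n ∸ 1

T^ : ℕ → Blk → Blk
T^ zero p = p
T^ (suc i) p = T (T^ i p)

record BS (k : ℕ) : Set where
  field
    seq : ℕ → Blk
    fin : ∀ i → IsFIN k (seq i)
    blk : ∀ i → seq i <ᵇ seq (suc i)
open BS public

record FB (k : ℕ) : Set where
  field
    blocks : List Blk
    finL   : All (IsFIN k) blocks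
    blkL   : Linked _<ᵇ_ blocks
open FB public

_≋_ : List Blk → List Blk → Set
xs ≋ ys = Pointwise _≈_ xs ys

nth : List Blk → ℕ → Blk
nth [] _ = λ _ → 0
nth (x ∷ xs) zero = x
nth (x ∷ xs) (suc n) = nth xs n

r : ∀ {k} → BS k → ℕ → List Blk
r A n = applyUpTo (seq A) n

-- [X]: combinations T^(i_0)(X_{n_0}) + ... + T^(i_l)(X_{n_l}),
-- n_0 < ... < n_l, i_j ≤ k, some i_j = 0.
-- A combination is a list of pairs (n_j , i_j).

Combo : Set
Combo = List (ℕ × ℕ)

evalC : (ℕ → Blk) → Combo → Blk
evalC X [] m = 0
evalC X ((n , i) ∷ c) m = T^ i (X n) m + evalC X c m

ValidCombo : ℕ → (ℕ → Set) → Combo → Set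
ValidCombo k P c = All (λ x → proj₂ x ≤ k × P (proj₁ x)) c
                 × Linked (λ x y → proj₁ x < proj₁ y) c
                 × Any (λ x → proj₂ x ≡ 0) c

-- p ∈ [X], where X is indexed by ℕ and P says which indices exist
InSpan : ℕ → (ℕ → Blk) → (ℕ → Set) → Blk → Set
InSpan k X P p = Σ Combo λ c → ValidCombo k P c × (p ≈ evalC X c)

Span∞ : ∀ {k} → BS k → Blk → Set
Span∞ {k} A p = InSpan k (seq A) (λ _ → ⊤) p

SpanL : ℕ → List Blk → Blk → Set
SpanL k xs p = InSpan k (nth xs) (λ n → n < length xs) p

_≤∞_ : ∀ {k} → BS k → BS k → Set
A ≤∞ B = ∀ i → Span∞ B (seq A i)

_≤L_ : ∀ {k} → FB k → List Blk → Set
_≤L_ {k} a ys = All (SpanL k ys) (blocks a)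

Cube : ∀ {k} → List Blk → BS k → BS k → Set
Cube a A B = (Σ ℕ λ n → r B n ≋ a) × (B ≤∞ A)

CubeN : ∀ {k} → ℕ → BS k → BS k → Set
CubeN n A B = Cube (r A n) A B

-- a ∈ FIN_k^{<∞} ↾ A  ⇔  [a,A] ≠ ∅
Restr : ∀ {k} → BS k → FB k → Set
Restr A a = Σ _ λ B → Cube (blocks a) A B

NonEmptyCube : ∀ {k} → FB k → BS k → Set
NonEmptyCube a B = Σ _ λ C → Cube (blocks a) B C

IsDepth : ∀ {k} → BS k → FB k → ℕ → Set
IsDepth A a n = (a ≤L r A n) × (∀ m → m < n → ¬ (a ≤L r A m))

-- A △ B finite (A, B viewed as the sets of their entries)

InRange : ∀ {k} → BS k → Blk → Set
InRange A p = Σ ℕ λ i → seq A i ≈ p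

SymDiffFin : ∀ {k} → BS k → BS k → Set
SymDiffFin A B = Σ (List Blk) λ L → ∀ p →
  ((InRange A p × ¬ InRange B p) ⊎ (InRange B p × ¬ InRange A p)) →
  Any (λ q → p ≈ q) L

-- O ⊆ FIN_k^{[d]} as a (extensional) predicate on lists of blocks
ExtPred : (List Blk → Set) → Set
ExtPred O = ∀ xs ys → xs ≋ ys → O xs → O ys

record IsCoideal (k : ℕ) (H : BS k → Set) : Set₁ where
  field
    cofinite : ∀ A B → H A → SymDiffFin A B → H B
    upward   : ∀ A B → H A → A ≤∞ B → H B
    condC₁   : ∀ A → H A → ∀ (a : FB k) → Restr A a → ∀ n → IsDepth A a n →
               ∀ B → CubeN n A B → H B → NonEmptyCube a B
    condC₂   : ∀ A → H A → ∀ (a : FB k) → Restr A a → ∀ n → IsDepth A a n →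
               ∀ B → H B → B ≤∞ A → NonEmptyCube a B →
               Σ (BS k) λ A' → CubeN n A A' × H A' × NonEmptyCube a A'
                 × (∀ C → Cube (blocks a) A' C → Cube (blocks a) B C)
    condD    : ∀ A → H A → ∀ (a : FB k) → Restr A a → ∀ n → IsDepth A a n →
               ∀ (O : List Blk → Set) → ExtPred O →
               Σ (BS k) λ B → CubeN n A B × H B
                 × ((∀ C → Cube (blocks a) B C → O (r C (suc (length (blocks a)))))
                   ⊎ (∀ C → Cube (blocks a) B C → ¬ O (r C (suc (length (blocks a))))))

DenseOpen : ∀ {k} → (BS k → Set) → (BS k → Set) → Set
DenseOpen D S = (∀ B → D B → S B)
              × (∀ A → S A → Σ _ λ B → D B × (B ≤∞ A))
              × (∀ A B → S A → D B → A ≤∞ B → D A)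

{-# OPTIONS --safe #-}
module Submission where

-- Up to extensional equality there are only finitely many a of depth n. A block in [r_n(A)]
-- is a combination of A_0, ..., A_{n-1}; the terms T^(i)(A_l) with i ≥ k vanish, so it is a
-- combination of pairs (l , i) with l < n and i < k. Consecutive blocks of a block sequence
-- use increasing sets of indices l (compare the points where the A_l reach k), and depth
-- exactly n means that the index n - 1 occurs. So only finitely many D_a belong to depth n,
-- and finitely many dense open subsets of H ∩ [n, A], which contains A, have a common
-- element: refine through them one at a time, openness keeping the earlier memberships.

open import Defs
open import Data.Nat using (ℕ; zero; suc; _+_; _∸_; _≤_; _<_; _⊔_; _≟_; _<?_; z≤n; s≤s)
open import Data.Nat.Properties
open import Data.Product using (Σ; _×_; _,_; proj₁; proj₂)
open import Data.Sum using (inj₁; inj₂)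
open import Data.Unit using (⊤; tt)
open import Data.Empty using (⊥-elim)
open import Data.List
  using (List; []; _∷_; length; map; applyUpTo; upTo; filter; cartesianProduct; cartesianProductWith)
open import Data.List.Properties using (length-applyUpTo; length-map)
open import Data.List.Relation.Unary.All using (All; []; _∷_)
import Data.List.Relation.Unary.All as All
import Data.List.Relation.Unary.All.Properties as Allₚ
open import Data.List.Relation.Unary.Any using (Any; here; there)
import Data.List.Relation.Unary.Any as Any
open import Data.List.Relation.Unary.Linked using (Linked; []; [-]; _∷_)
import Data.List.Relation.Unary.Linked as Linked
import Data.List.Relation.Unary.Linked.Properties as Linkedₚ
open import Data.List.Relation.Binary.Pointwise using ([]; _∷_; All-resp-Pointwise)
import Data.List.Relation.Binary.Pointwise.Properties as Pointwiseₚ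
open import Data.List.Membership.Propositional using (_∈_; find; lose)
open import Data.List.Membership.Propositional.Properties
  using (∈-cartesianProductWith⁺; ∈-cartesianProduct⁺; ∈-upTo⁺; ∈-filter⁺)
open import Relation.Binary using (Transitive; tri<; tri≈; tri>)
open import Function using (_∘_)
open import Relation.Binary.PropositionalEquality
  using (_≡_; _≢_; refl; sym; trans; cong; cong₂; cong-app; subst; module ≡-Reasoning)
open import Relation.Nullary using (¬_; Dec; yes; no)
open import Relation.Nullary.Decidable using (_×-dec_)
open import Relation.Unary using (Decidable)

T^-≡-∸ : ∀ i p m → T^ i p m ≡ p m ∸ i
T^-≡-∸ zero    p m = refl
T^-≡-∸ (suc i) p m = begin
  T^ i p m ∸ 1   ≡⟨ cong (_∸ 1) (T^-≡-∸ i p m) ⟩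
  p m ∸ i ∸ 1    ≡⟨ ∸-+-assoc (p m) i 1 ⟩
  p m ∸ (i + 1)  ≡⟨ cong (p m ∸_) (+-comm i 1) ⟩
  p m ∸ suc i    ∎
  where open ≡-Reasoning

T^-≤ : ∀ i p m → T^ i p m ≤ p m
T^-≤ i p m = ≤-trans (≤-reflexive (T^-≡-∸ i p m)) (m∸n≤m (p m) i)

T^-vanishes : ∀ i p m → p m ≡ 0 → T^ i p m ≡ 0
T^-vanishes i p m pm≡0 = n≤0⇒n≡0 (subst (T^ i p m ≤_) pm≡0 (T^-≤ i p m))

T^-cong : ∀ i {p q} → p ≈ q → T^ i p ≈ T^ i q
T^-cong zero    p≈q m = p≈q m
T^-cong (suc i) p≈q m = cong (_∸ 1) (T^-cong i p≈q m)

module _ (f : ℕ → Blk) where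

  T^-≤-evalC : ∀ {c l i} m → (l , i) ∈ c → T^ i (f l) m ≤ evalC f c m
  T^-≤-evalC m (here refl)  = m≤m+n _ _
  T^-≤-evalC m (there x∈c) = ≤-trans (T^-≤-evalC m x∈c) (m≤n+m _ _)

  evalC-vanishes : ∀ c m → All (λ x → f (proj₁ x) m ≡ 0) c → evalC f c m ≡ 0
  evalC-vanishes []            m []       = refl
  evalC-vanishes ((l , i) ∷ c) m (z ∷ zs) =
    cong₂ _+_ (T^-vanishes i (f l) m z) (evalC-vanishes c m zs)

  evalC-support : ∀ c m → evalC f c m ≢ 0 → Any (λ x → f (proj₁ x) m ≢ 0) c
  evalC-support []            m ne = ⊥-elim (ne refl)
  evalC-support ((l , i) ∷ c) m ne with f l m ≟ 0
  ... | no  flm≢0 = here flm≢0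
  ... | yes flm≡0 =
    there (evalC-support c m (λ e → ne (cong₂ _+_ (T^-vanishes i (f l) m flm≡0) e)))

  evalC-filter : ∀ {P : ℕ × ℕ → Set} (P? : Decidable P) c →
                 All (λ x → ¬ P x → ∀ m → T^ (proj₂ x) (f (proj₁ x)) m ≡ 0) c →
                 evalC f c ≈ evalC f (filter P? c)
  evalC-filter P? []            []         m = refl
  evalC-filter P? ((l , i) ∷ c) (dropped ∷ ds) m with P? (l , i)
  ... | yes _  = cong (T^ i (f l) m +_) (evalC-filter P? c ds m)
  ... | no ¬Px = trans (cong (_+ evalC f c m) (dropped ¬Px m)) (evalC-filter P? c ds m)

evalC-cong : ∀ {f g} c → All (λ x → f (proj₁ x) ≈ g (proj₁ x)) c → evalC f c ≈ evalC g c
evalC-cong []            []       m = refl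
evalC-cong ((l , i) ∷ c) (e ∷ es) m = cong₂ _+_ (T^-cong i e m) (evalC-cong c es m)

InSpan-transport : ∀ {k f g P Q p} → (∀ {l} → P l → Q l × f l ≈ g l) →
                   InSpan k f P p → InSpan k g Q p
InSpan-transport h (c , (entries , sorted , base) , p≈c) =
  c , (All.map (λ (i≤k , Pl) → i≤k , proj₁ (h Pl)) entries , sorted , base) ,
  λ m → trans (p≈c m) (evalC-cong c (All.map (λ (_ , Pl) → proj₂ (h Pl)) entries) m)

InSpan-resp-≈ : ∀ {k f P p q} → p ≈ q → InSpan k f P p → InSpan k f P q
InSpan-resp-≈ p≈q (c , valid , p≈c) = c , valid , λ m → trans (sym (p≈q m)) (p≈c m)

Sorted : Combo → Set
Sorted = Linked (λ x y → proj₁ x < proj₁ y)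

Precedes : Combo → Combo → Set
Precedes c c' = All (λ x → All (λ y → proj₁ x < proj₁ y) c') c

precedes? : ∀ c c' → Dec (Precedes c c')
precedes? c c' = All.all? (λ x → All.all? (λ y → proj₁ x <? proj₁ y) c') c

lead : Combo → ℕ
lead []            = 0
lead ((l , _) ∷ _) = l

Linked-head : ∀ {A : Set} {R : A → A → Set} → Transitive R →
              ∀ {x xs} → Linked R (x ∷ xs) → All (R x) xs
Linked-head R-trans [-]      = []
Linked-head R-trans (r ∷ rs) = Linkedₚ.Linked⇒All R-trans r rs

increasing-length≤ : ∀ {n xs} → Linked _<_ xs → All (_< n) xs → length xs ≤ n
increasing-length≤ increasing bounded = go increasing (All.map (z≤n ,_) bounded)
  where
  go : ∀ {b m xs} → Linked _<_ xs → All (λ x → b ≤ x × x < b + m) xs → length xs ≤ m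
  go {xs = []} _ _ = z≤n
  go {b} {zero} {_ ∷ _} _ ((b≤x , x<b+0) ∷ _) =
    ⊥-elim (<-irrefl (sym (+-identityʳ b)) (≤-<-trans b≤x x<b+0))
  go {b} {suc m} {_ ∷ _} inc ((b≤x , _) ∷ bounds) =
    s≤s (go (Linked.tail inc) (All.zipWith shift (Linked-head <-trans inc , bounds)))
    where
    shift : ∀ {y} → _ < y × (b ≤ y × y < b + suc m) → suc b ≤ y × y < suc b + m
    shift {y} (x<y , _ , y<) = ≤-<-trans b≤x x<y , subst (y <_) (+-suc b m) y<

listsOfLength≤ : ∀ {A : Set} → ℕ → List A → List (List A)
listsOfLength≤ zero    U = [] ∷ []
listsOfLength≤ (suc m) U = [] ∷ cartesianProductWith _∷_ U (listsOfLength≤ m U)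

∈-listsOfLength≤ : ∀ {A : Set} {U : List A} m {xs} → length xs ≤ m → All (_∈ U) xs →
                   xs ∈ listsOfLength≤ m U
∈-listsOfLength≤ zero    {[]}     _           _             = here refl
∈-listsOfLength≤ (suc m) {[]}     _           _             = here refl
∈-listsOfLength≤ (suc m) {_ ∷ _} (s≤s len≤m) (x∈U ∷ xs⊆U) =
  there (∈-cartesianProductWith⁺ _∷_ x∈U (∈-listsOfLength≤ m len≤m xs⊆U))

nth-applyUpTo : ∀ f n {l} → l < n → nth (applyUpTo f n) l ≡ f l
nth-applyUpTo f (suc n) {zero}  _         = refl
nth-applyUpTo f (suc n) {suc l} (s≤s l<n) = nth-applyUpTo (λ j → f (suc j)) n l<n

prepend : ∀ {A : Set} → List A → (ℕ → A) → ℕ → A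
prepend []       g i       = g i
prepend (x ∷ xs) g zero    = x
prepend (x ∷ xs) g (suc i) = prepend xs g i

prepend-All : ∀ {A : Set} {P : A → Set} xs g → All P xs → (∀ i → P (g i)) →
              ∀ i → P (prepend xs g i)
prepend-All []       g []       Pg i       = Pg i
prepend-All (x ∷ xs) g (Px ∷ _) Pg zero    = Px
prepend-All (x ∷ xs) g (_ ∷ Ps) Pg (suc i) = prepend-All xs g Ps Pg i

prepend-Linked : ∀ {A : Set} {R : A → A → Set} xs g → Linked R xs → All (λ x → R x (g 0)) xs →
                 (∀ i → R (g i) (g (suc i))) → ∀ i → R (prepend xs g i) (prepend xs g (suc i))
prepend-Linked []           g _        _         Rg i       = Rg i
prepend-Linked (x ∷ [])     g _        (Rxg ∷ _) Rg zero    = Rxg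
prepend-Linked (x ∷ [])     g _        _         Rg (suc i) = Rg i
prepend-Linked (x ∷ y ∷ xs) g (Rxy ∷ _) _        Rg zero    = Rxy
prepend-Linked (x ∷ y ∷ xs) g (_ ∷ Rs) (_ ∷ Rsg) Rg (suc i) =
  prepend-Linked (y ∷ xs) g Rs Rsg Rg i

applyUpTo-prepend : ∀ {A : Set} (xs : List A) g → applyUpTo (prepend xs g) (length xs) ≡ xs
applyUpTo-prepend []       g = refl
applyUpTo-prepend (x ∷ xs) g = cong (x ∷_) (applyUpTo-prepend xs g)

≋-refl : ∀ {xs} → xs ≋ xs
≋-refl = Pointwiseₚ.refl (λ _ → refl)

≋-sym : ∀ {xs ys} → xs ≋ ys → ys ≋ xs
≋-sym = Pointwiseₚ.symmetric (λ p≈q m → sym (p≈q m))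

<ᵇ-trans : ∀ {p q s} w → q w ≢ 0 → p <ᵇ q → q <ᵇ s → p <ᵇ s
<ᵇ-trans w qw≢0 p<q q<s m n pm≢0 sn≢0 = <-trans (p<q m w pm≢0 qw≢0) (q<s w n qw≢0 sn≢0)

<ᵇ-resp-≈ : ∀ {p p' q q'} → p ≈ p' → q ≈ q' → p <ᵇ q → p' <ᵇ q'
<ᵇ-resp-≈ p≈p' q≈q' p<q m n p'm≢0 q'n≢0 =
  p<q m n (λ pm≡0 → p'm≢0 (trans (sym (p≈p' m)) pm≡0))
          (λ qn≡0 → q'n≢0 (trans (sym (q≈q' n)) qn≡0))

Linked-<ᵇ-resp-≋ : ∀ {xs ys} → xs ≋ ys → Linked _<ᵇ_ xs → Linked _<ᵇ_ ys
Linked-<ᵇ-resp-≋ []                    []          = []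
Linked-<ᵇ-resp-≋ (_ ∷ [])              [-]         = [-]
Linked-<ᵇ-resp-≋ (x≈x' ∷ y≈y' ∷ xs≋ys) (x<y ∷ rest) =
  <ᵇ-resp-≈ x≈x' y≈y' x<y ∷ Linked-<ᵇ-resp-≋ (y≈y' ∷ xs≋ys) rest

prepend∞ : ∀ {k} (a : FB k) (B : BS k) → All (_<ᵇ seq B 0) (blocks a) → BS k
prepend∞ a B a<B = record
  { seq = prepend (blocks a) (seq B)
  ; fin = prepend-All (blocks a) (seq B) (finL a) (fin B)
  ; blk = prepend-Linked (blocks a) (seq B) (blkL a) a<B (blk B)
  }

finite-denseOpen-meet : ∀ {k} {I : Set} (S : BS k → Set) (D : I → BS k → Set) (is : List I) →
                        All (λ i → DenseOpen (D i) S) is → ∀ {A} → S A →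
                        Σ (BS k) λ B → S B × All (λ i → D i B) is
finite-denseOpen-meet S D []       []                                 A∈S = _ , A∈S , []
finite-denseOpen-meet S D (i ∷ is) ((Dᵢ⊆S , Dᵢ-dense , _) ∷ denseOpens) A∈S =
  let B , B∈S , B∈Ds = finite-denseOpen-meet S D is denseOpens A∈S
      B' , B'∈Dᵢ , B'≤B = Dᵢ-dense B B∈S
      B'∈S = Dᵢ⊆S B' B'∈Dᵢ
  in B' , B'∈S ,
     B'∈Dᵢ ∷ All.zipWith (λ ((_ , _ , D-open) , B∈D) → D-open B' B B'∈S B∈D B'≤B) (denseOpens , B∈Ds)

module _ {k : ℕ} (A : BS k) where

  span-seq : ∀ l → Span∞ A (seq A l)
  span-seq l = ((l , 0) ∷ []) , ((z≤n , tt) ∷ [] , [-] , here refl) , λ m → sym (+-identityʳ _)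

  cubeN-self : ∀ n → CubeN n A A
  cubeN-self n = (n , ≋-refl) , span-seq

  SpanL-r⇒InSpan : ∀ {n p} → SpanL k (r A n) p → InSpan k (seq A) (_< n) p
  SpanL-r⇒InSpan {n} = InSpan-transport λ {l} l<len →
    let l<n = subst (l <_) (length-applyUpTo (seq A) n) l<len
    in l<n , cong-app (nth-applyUpTo (seq A) n l<n)

  InSpan⇒SpanL-r : ∀ {n p} → InSpan k (seq A) (_< n) p → SpanL k (r A n) p
  InSpan⇒SpanL-r {n} = InSpan-transport λ {l} l<n →
    subst (l <_) (sym (length-applyUpTo (seq A) n)) l<n ,
    λ m → sym (cong-app (nth-applyUpTo (seq A) n l<n) m)

  InSpan⇒Span∞ : ∀ {P p} → InSpan k (seq A) P p → Span∞ A p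
  InSpan⇒Span∞ = InSpan-transport λ _ → tt , λ _ → refl

  -- Indexing by i + n rather than n + i makes blk A (i + n) have the required type on the nose.
  drop∞ : ℕ → BS k
  drop∞ n = record
    { seq = λ i → seq A (i + n)
    ; fin = λ i → fin A (i + n)
    ; blk = λ i → blk A (i + n)
    }

  restr-if-below : ∀ (a : FB k) n → All (Span∞ A) (blocks a) → All (_<ᵇ seq A n) (blocks a) →
                   Restr A a
  restr-if-below a n a⊆[A] a<Aₙ =
    prepend∞ a (drop∞ n) a<Aₙ ,
    (length (blocks a) , subst (_≋ blocks a) (sym (applyUpTo-prepend (blocks a) _)) ≋-refl) ,
    prepend-All (blocks a) _ a⊆[A] (λ i → span-seq (i + n))

module DepthClass {k : ℕ} (1≤k : 1 ≤ k) (A : BS k) where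

  private
    X : ℕ → Blk
    X = seq A

  peak : ℕ → ℕ
  peak l = proj₁ (proj₂ (proj₂ (fin A l)))

  X-peak : ∀ l → X l (peak l) ≡ k
  X-peak l = proj₂ (proj₂ (proj₂ (fin A l)))

  X-peak≢0 : ∀ l → X l (peak l) ≢ 0
  X-peak≢0 l Xl≡0 = <⇒≢ 1≤k (trans (sym Xl≡0) (X-peak l))

  X-<ᵇ : ∀ {l l'} → l < l' → X l <ᵇ X l'
  X-<ᵇ {l} {suc l'} (s≤s l≤l') with m≤n⇒m<n∨m≡n l≤l'
  ... | inj₁ l<l' = <ᵇ-trans (peak l') (X-peak≢0 l') (X-<ᵇ l<l') (blk A l')
  ... | inj₂ refl = blk A l

  X-disjoint : ∀ {l l' m} → l ≢ l' → X l m ≢ 0 → X l' m ≡ 0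
  X-disjoint {l} {l'} {m} l≢l' Xlm≢0 with X l' m ≟ 0 | <-cmp l l'
  ... | yes Xl'm≡0 | _              = Xl'm≡0
  ... | no  _      | tri≈ _ l≡l' _  = ⊥-elim (l≢l' l≡l')
  ... | no  Xl'm≢0 | tri< l<l' _ _  = ⊥-elim (<-irrefl refl (X-<ᵇ l<l' m m Xlm≢0 Xl'm≢0))
  ... | no  Xl'm≢0 | tri> _ _ l'<l  = ⊥-elim (<-irrefl refl (X-<ᵇ l'<l m m Xl'm≢0 Xlm≢0))

  peak-<⇒< : ∀ {l l'} → peak l < peak l' → l < l'
  peak-<⇒< {l} {l'} peak< with <-cmp l l'
  ... | tri< l<l' _ _ = l<l'
  ... | tri≈ _ refl _ = ⊥-elim (<-irrefl refl peak<)
  ... | tri> _ _ l'<l =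
    ⊥-elim (<-asym peak< (X-<ᵇ l'<l (peak l') (peak l) (X-peak≢0 l') (X-peak≢0 l)))

  T^-beyond-k : ∀ i l m → k ≤ i → T^ i (X l) m ≡ 0
  T^-beyond-k i l m k≤i = trans (T^-≡-∸ i (X l) m) (m≤n⇒m∸n≡0 (≤-trans (proj₁ (fin A l) m) k≤i))

  evalC-≤k : ∀ c → Sorted c → ∀ m → evalC X c m ≤ k
  evalC-≤k []            _      m = z≤n
  evalC-≤k ((l , i) ∷ c) sorted m with X l m ≟ 0
  ... | yes Xlm≡0 rewrite T^-vanishes i (X l) m Xlm≡0 = evalC-≤k c (Linked.tail sorted) m
  ... | no  Xlm≢0
    rewrite evalC-vanishes X c m
              (All.map (λ l<j → X-disjoint (<⇒≢ l<j) Xlm≢0) (Linked-head <-trans sorted))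
          | +-identityʳ (T^ i (X l) m)
    = ≤-trans (T^-≤ i (X l) m) (proj₁ (fin A l) m)

  evalC-finite-support : ∀ c → Σ ℕ λ N → ∀ m → N ≤ m → evalC X c m ≡ 0
  evalC-finite-support []            = 0 , λ _ _ → refl
  evalC-finite-support ((l , i) ∷ c) =
    let N  , vanish  = evalC-finite-support c
        N' , vanish' = proj₁ (proj₂ (fin A l))
    in N ⊔ N' , λ m N⊔N'≤m →
         cong₂ _+_ (T^-vanishes i (X l) m (vanish' m (≤-trans (m≤n⊔m N N') N⊔N'≤m)))
                   (vanish m (≤-trans (m≤m⊔n N N') N⊔N'≤m))

  evalC-peak-pos : ∀ {c l i} → (l , i) ∈ c → i < k → 0 < evalC X c (peak l)
  evalC-peak-pos {c} {l} {i} l,i∈c i<k = begin-strict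
    0                    <⟨ m<n⇒0<n∸m i<k ⟩
    k ∸ i                ≡⟨ cong (_∸ i) (sym (X-peak l)) ⟩
    X l (peak l) ∸ i     ≡⟨ sym (T^-≡-∸ i (X l) (peak l)) ⟩
    T^ i (X l) (peak l)  ≤⟨ T^-≤-evalC X (peak l) l,i∈c ⟩
    evalC X c (peak l)   ∎
    where open ≤-Reasoning

  evalC-IsFIN : ∀ {c} → Sorted c → Any (λ x → proj₂ x ≡ 0) c → IsFIN k (evalC X c)
  evalC-IsFIN {c} sorted base with find base
  ... | (l , _) , l,0∈c , refl =
    evalC-≤k c sorted , evalC-finite-support c ,
    peak l , ≤-antisym (evalC-≤k c sorted (peak l))
                       (subst (_≤ evalC X c (peak l)) (X-peak l) (T^-≤-evalC X (peak l) l,0∈c))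

  Precedes⇒<ᵇ : ∀ {c c'} → Precedes c c' → evalC X c <ᵇ evalC X c'
  Precedes⇒<ᵇ {c} {c'} c≺c' m m' cm≢0 c'm'≢0
    with find (evalC-support X c m cm≢0) | find (evalC-support X c' m' c'm'≢0)
  ... | _ , x∈c , Xlm≢0 | _ , y∈c' , Xl'm'≢0 =
    X-<ᵇ (All.lookup (All.lookup c≺c' x∈c) y∈c') m m' Xlm≢0 Xl'm'≢0

  <ᵇ⇒Precedes : ∀ {c c'} → All (λ x → proj₂ x < k) c → All (λ y → proj₂ y < k) c' →
                evalC X c <ᵇ evalC X c' → Precedes c c'
  <ᵇ⇒Precedes low low' c<c' = All.tabulate λ x∈c → All.tabulate λ y∈c' →
    peak-<⇒< (c<c' _ _ (n>0⇒n≢0 (evalC-peak-pos x∈c (All.lookup low x∈c)))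
                       (n>0⇒n≢0 (evalC-peak-pos y∈c' (All.lookup low' y∈c'))))

  Entry : ℕ → ℕ × ℕ → Set
  Entry n x = proj₁ x < n × proj₂ x < k

  NormalCombo : ℕ → Combo → Set
  NormalCombo n c = All (Entry n) c × Sorted c × Any (λ x → proj₂ x ≡ 0) c

  NormalCombo-low : ∀ {n c} → NormalCombo n c → All (λ x → proj₂ x < k) c
  NormalCombo-low (entries , _ , _) = All.map proj₂ entries

  NormalCombo⇒ValidCombo : ∀ {n c} → NormalCombo n c → ValidCombo k (_< n) c
  NormalCombo⇒ValidCombo (entries , sorted , base) =
    All.map (λ (l<n , i<k) → <⇒≤ i<k , l<n) entries , sorted , base

  NormalCombo-SpanL : ∀ {n c} → NormalCombo n c → SpanL k (r A n) (evalC X c)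
  NormalCombo-SpanL nc = InSpan⇒SpanL-r A (_ , NormalCombo⇒ValidCombo nc , λ _ → refl)

  NormalCombo-below : ∀ {n c} → NormalCombo n c → evalC X c <ᵇ X n
  NormalCombo-below {n} {c} (entries , _ , _) m m' cm≢0 Xnm'≢0
    with find (evalC-support X c m cm≢0)
  ... | _ , x∈c , Xlm≢0 = X-<ᵇ (proj₁ (All.lookup entries x∈c)) m m' Xlm≢0 Xnm'≢0

  normalize : ∀ {n p} → InSpan k X (_< n) p → Σ Combo λ c → NormalCombo n c × p ≈ evalC X c
  normalize {n} (c , (entries , sorted , base) , p≈c) =
    filter low? c ,
    (All.zipWith (λ ((_ , l<n) , i<k) → l<n , i<k)
                 (Allₚ.filter⁺ low? entries , Allₚ.all-filter low? c) ,
     Linkedₚ.filter⁺ low? <-trans sorted ,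
     base-kept) ,
    λ m → trans (p≈c m) (evalC-filter X low? c (All.universal dropped-vanishes c) m)
    where
    low? : Decidable (λ (x : ℕ × ℕ) → proj₂ x < k)
    low? x = proj₂ x <? k
    dropped-vanishes : ∀ x → ¬ proj₂ x < k → ∀ m → T^ (proj₂ x) (X (proj₁ x)) m ≡ 0
    dropped-vanishes (l , i) i≮k m = T^-beyond-k i l m (≮⇒≥ i≮k)
    base-kept : Any (λ x → proj₂ x ≡ 0) (filter low? c)
    base-kept = let _ , x∈c , i≡0 = find base
                in lose (∈-filter⁺ low? x∈c (subst (_< k) (sym i≡0) 1≤k)) i≡0

  SpanL-r-vanishes : ∀ {m l p} → m ≤ l → SpanL k (r A m) p → p (peak l) ≡ 0
  SpanL-r-vanishes {m} {l} m≤l span with SpanL-r⇒InSpan A span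
  ... | c , (entries , _ , _) , p≈c =
    trans (p≈c (peak l))
          (evalC-vanishes X c (peak l)
            (All.map (λ (_ , j<m) → X-disjoint (>⇒≢ (<-≤-trans j<m m≤l)) (X-peak≢0 l)) entries))

  Reaches : ℕ → List Combo → Set
  Reaches zero    cs = ⊤
  Reaches (suc n) cs = Any (Any (λ x → proj₁ x ≡ n)) cs

  Good : ℕ → List Combo → Set
  Good n cs = All (NormalCombo n) cs × Linked Precedes cs × Reaches n cs

  reaches? : ∀ n cs → Dec (Reaches n cs)
  reaches? zero    cs = yes tt
  reaches? (suc n) cs = Any.any? (Any.any? (λ x → proj₁ x ≟ n)) cs

  good? : ∀ n cs → Dec (Good n cs)
  good? n cs =
    All.all? normalCombo? cs ×-dec Linked.linked? precedes? cs ×-dec reaches? n cs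
    where
    normalCombo? : Decidable (NormalCombo n)
    normalCombo? c = All.all? (λ x → (proj₁ x <? n) ×-dec (proj₂ x <? k)) c
                     ×-dec Linked.linked? (λ x y → proj₁ x <? proj₁ y) c
                     ×-dec Any.any? (λ x → proj₂ x ≟ 0) c

  goodFB : ∀ {n cs} → Good n cs → FB k
  goodFB {cs = cs} good = record
    { blocks = map (evalC X) cs
    ; finL   = Allₚ.map⁺ (All.map (λ (_ , sorted , base) → evalC-IsFIN sorted base) (proj₁ good))
    ; blkL   = Linkedₚ.map⁺ (Linked.map Precedes⇒<ᵇ (proj₁ (proj₂ good)))
    }

  Reaches⇒not-shallower : ∀ {n cs} → All (NormalCombo n) cs → Reaches n cs →
                          ∀ m → m < n → ¬ All (SpanL k (r A m)) (map (evalC X) cs)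
  Reaches⇒not-shallower {suc n} normal reaches m (s≤s m≤n) spans with find reaches
  ... | c , c∈cs , reach with find reach
  ...   | _ , x∈c , refl =
    n>0⇒n≢0 (evalC-peak-pos x∈c (All.lookup (NormalCombo-low (All.lookup normal c∈cs)) x∈c))
            (SpanL-r-vanishes m≤n (All.lookup (Allₚ.map⁻ spans) c∈cs))

  goodFB-IsDepth : ∀ {n cs} (good : Good n cs) → IsDepth A (goodFB good) n
  goodFB-IsDepth (normal , _ , reaches) =
    Allₚ.map⁺ (All.map NormalCombo-SpanL normal) , Reaches⇒not-shallower normal reaches

  goodFB-Restr : ∀ {n cs} (good : Good n cs) → Restr A (goodFB good)
  goodFB-Restr {n} good@(normal , _ , _) = restr-if-below A (goodFB good) n
    (Allₚ.map⁺ (All.map (λ nc → InSpan⇒Span∞ A (_ , NormalCombo⇒ValidCombo nc , λ _ → refl))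
                        normal))
    (Allₚ.map⁺ (All.map NormalCombo-below normal))

  NormalCombo-shrink : ∀ {n c} → NormalCombo (suc n) c → ¬ Any (λ x → proj₁ x ≡ n) c →
                       NormalCombo n c
  NormalCombo-shrink {n} {c} (entries , sorted , base) ¬reach =
    All.zipWith (λ ((l<1+n , i<k) , l≢n) → ≤∧≢⇒< (≤-pred l<1+n) l≢n , i<k)
                (entries , Allₚ.¬Any⇒All¬ c ¬reach) ,
    sorted , base

  minimal⇒Reaches : ∀ {n cs} → All (NormalCombo n) cs →
                    (∀ m → m < n → ¬ All (SpanL k (r A m)) (map (evalC X) cs)) → Reaches n cs
  minimal⇒Reaches {zero}  _      _       = tt
  minimal⇒Reaches {suc n} {cs} normal minimal with reaches? (suc n) cs
  ... | yes reaches = reaches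
  ... | no ¬reaches =
    ⊥-elim (minimal n ≤-refl
      (Allₚ.map⁺ (All.map NormalCombo-SpanL
        (All.zipWith (λ (nc , ¬reach) → NormalCombo-shrink nc ¬reach)
                     (normal , Allₚ.¬Any⇒All¬ cs ¬reaches)))))

  choose-combos : ∀ {n ps} → All (λ p → Σ Combo λ c → NormalCombo n c × p ≈ evalC X c) ps →
                  Σ (List Combo) λ cs → All (NormalCombo n) cs × ps ≋ map (evalC X) cs
  choose-combos []                    = [] , [] , []
  choose-combos ((c , nc , p≈c) ∷ hs) =
    let cs , ncs , ps≋cs = choose-combos hs in c ∷ cs , nc ∷ ncs , p≈c ∷ ps≋cs

  linked-Precedes : ∀ {n cs} → All (NormalCombo n) cs → Linked _<ᵇ_ (map (evalC X) cs) →
                    Linked Precedes cs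
  linked-Precedes {cs = []}        _                 _             = []
  linked-Precedes {cs = _ ∷ []}    _                 _             = [-]
  linked-Precedes {cs = _ ∷ _ ∷ _} (nc ∷ nc' ∷ ncs) (c<c' ∷ rest) =
    <ᵇ⇒Precedes (NormalCombo-low nc) (NormalCombo-low nc') c<c' ∷
    linked-Precedes (nc' ∷ ncs) rest

  IsDepth⇒Good : ∀ {a n} → IsDepth A a n →
                 Σ (List Combo) λ cs → Good n cs × blocks a ≋ map (evalC X) cs
  IsDepth⇒Good {a} (spans , minimal) =
    let cs , normal , a≋cs = choose-combos (All.map (normalize ∘ SpanL-r⇒InSpan A) spans)
    in cs ,
       (normal ,
        linked-Precedes normal (Linked-<ᵇ-resp-≋ a≋cs (blkL a)) ,
        minimal⇒Reaches normal
          (λ m m<n → minimal m m<n ∘ All-resp-Pointwise InSpan-resp-≈ (≋-sym a≋cs))) ,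
       a≋cs

  lead-< : ∀ {n c} → NormalCombo n c → lead c < n
  lead-< ((l<n , _) ∷ _ , _ , _) = l<n

  lead-<-Precedes : ∀ {n c c'} → NormalCombo n c → NormalCombo n c' → Precedes c c' →
                    lead c < lead c'
  lead-<-Precedes {c = []}    (_ , _ , ()) _ _
  lead-<-Precedes {c' = []}   _ (_ , _ , ()) _
  lead-<-Precedes {c = _ ∷ _} {_ ∷ _} _ _ ((x<y ∷ _) ∷ _) = x<y

  leads-increasing : ∀ {n cs} → All (NormalCombo n) cs → Linked Precedes cs →
                     Linked (λ c c' → lead c < lead c') cs
  leads-increasing _                 []           = []
  leads-increasing _                 [-]          = [-]
  leads-increasing (nc ∷ nc' ∷ ncs) (prec ∷ precs) =
    lead-<-Precedes nc nc' prec ∷ leads-increasing (nc' ∷ ncs) precs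

  NormalCombo-length≤ : ∀ {n c} → NormalCombo n c → length c ≤ n
  NormalCombo-length≤ {n} {c} (entries , sorted , _) =
    subst (_≤ n) (length-map proj₁ c)
      (increasing-length≤ (Linkedₚ.map⁺ sorted) (Allₚ.map⁺ (All.map proj₁ entries)))

  Good-length≤ : ∀ {n cs} → All (NormalCombo n) cs → Linked Precedes cs → length cs ≤ n
  Good-length≤ {n} {cs} normal precs =
    subst (_≤ n) (length-map lead cs)
      (increasing-length≤ (Linkedₚ.map⁺ (leads-increasing normal precs))
                          (Allₚ.map⁺ (All.map lead-< normal)))

  candidates : ℕ → List (List Combo)
  candidates n = listsOfLength≤ n (listsOfLength≤ n (cartesianProduct (upTo n) (upTo k)))

  Good⇒∈candidates : ∀ {n cs} → Good n cs → cs ∈ candidates n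
  Good⇒∈candidates {n} (normal , precs , _) =
    ∈-listsOfLength≤ n (Good-length≤ normal precs) (All.map combo∈ normal)
    where
    combo∈ : ∀ {c} → NormalCombo n c → c ∈ listsOfLength≤ n (cartesianProduct (upTo n) (upTo k))
    combo∈ nc@(entries , _ , _) =
      ∈-listsOfLength≤ n (NormalCombo-length≤ nc)
        (All.map (λ (l<n , i<k) → ∈-cartesianProduct⁺ (∈-upTo⁺ l<n) (∈-upTo⁺ i<k)) entries)

  goodFBs : ℕ → List (List Combo) → List (FB k)
  goodFBs n []         = []
  goodFBs n (cs ∷ css) with good? n cs
  ... | yes good = goodFB good ∷ goodFBs n css
  ... | no  _    = goodFBs n css

  goodFBs-sound : ∀ n css → All (λ a → Restr A a × IsDepth A a n) (goodFBs n css)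
  goodFBs-sound n []         = []
  goodFBs-sound n (cs ∷ css) with good? n cs
  ... | yes good = (goodFB-Restr good , goodFB-IsDepth good) ∷ goodFBs-sound n css
  ... | no  _    = goodFBs-sound n css

  goodFBs-complete : ∀ {n cs css} → cs ∈ css → Good n cs →
                     Any (λ a → blocks a ≡ map (evalC X) cs) (goodFBs n css)
  goodFBs-complete {n} {cs} (here refl) good with good? n cs
  ... | yes _     = here refl
  ... | no  ¬good = ⊥-elim (¬good good)
  goodFBs-complete {n} {css = cs' ∷ _} (there cs∈css) good with good? n cs'
  ... | yes _ = there (goodFBs-complete cs∈css good)
  ... | no  _ = goodFBs-complete cs∈css good

  depthClass : ℕ → List (FB k)
  depthClass n = goodFBs n (candidates n)

  depthClass-sound : ∀ n → All (λ a → Restr A a × IsDepth A a n) (depthClass n)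
  depthClass-sound n = goodFBs-sound n (candidates n)

  depthClass-complete : ∀ {a : FB k} {n} → IsDepth A a n →
                        Any (λ a' → blocks a' ≋ blocks a) (depthClass n)
  depthClass-complete {a} {n} depth =
    let cs , good , a≋cs = IsDepth⇒Good {a} {n} depth
    in Any.map (λ a'≡cs → subst (_≋ blocks a) (sym a'≡cs) (≋-sym a≋cs))
               (goodFBs-complete {n} (Good⇒∈candidates good) good)

lemma2p11 : (k : ℕ) → 1 ≤ k → (H : BS k → Set) → IsCoideal k H →
            (A : BS k) → H A →
            (D : FB k → BS k → Set) →
            (∀ a a' → Restr A a → blocks a ≋ blocks a' → ∀ B → D a B → D a' B) →
            (∀ a → Restr A a → ∀ n → IsDepth A a n →
               DenseOpen (D a) (λ B → H B × CubeN n A B)) →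
            Σ (ℕ → BS k) λ As → (∀ n → H (As n) × (As n ≤∞ A))
              × (∀ a → Restr A a → ∀ n → IsDepth A a n → D a (As n))
lemma2p11 k 1≤k H _ A A∈H D D-resp D-dense = As , As∈H∩[A] , As∈D
  where
  open DepthClass 1≤k A

  refined : ∀ n → Σ (BS k) λ B → (H B × CubeN n A B) × All (λ a → D a B) (depthClass n)
  refined n = finite-denseOpen-meet (λ B → H B × CubeN n A B) D (depthClass n)
                (All.map (λ (restr , depth) → D-dense _ restr n depth) (depthClass-sound n))
                (A∈H , cubeN-self A n)

  As : ℕ → BS k
  As n = proj₁ (refined n)

  As∈H∩[A] : ∀ n → H (As n) × (As n ≤∞ A)
  As∈H∩[A] n = let (B∈H , _ , B≤A) , _ = proj₂ (refined n) in B∈H , B≤A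

  As∈D : ∀ a → Restr A a → ∀ n → IsDepth A a n → D a (As n)
  As∈D a _ n depth =
    All.lookupWith {R = λ _ → D a (As n)}
      (λ ((restr , _) , a'∈D) a'≋a → D-resp _ a restr a'≋a (As n) a'∈D)
      (All.zip (depthClass-sound n , proj₂ (proj₂ (refined n))))
      (depthClass-complete {a} {n} depth)
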